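{- Let $Q_1$ be a quiver on vertex set $[N_1]$ and $Q_2$ a quiver on vertex set $[N_1+1,N_1+N_2]$. Fix a vertex $a\in (Q_1)_0$ and pairwise distinct vertices $b_1,\dots,b_r\in (Q_2)_0$, and let $Q=Q_1\oplus_{(a,\dots,a)}^{(b_1,\dots,b_r)}Q_2$. Let $a'$ be the frozen vertex of $\widehat{Q}$ corresponding to $a$. Let $\underline{\mu}=\mu_{i_d}\circ\cdots\circ\mu_{i_1}$ be a mutation sequence with every $i_j\in (Q_1)_0$, let $Q^{(0)}=\widehat{Q}$ and $Q^{(k)}=(\mu_{i_k}\circ\cdots\circ\mu_{i_1})(\widehat{Q})$ for $1\le k\le d$, and for vertices $x,y$ put $\alpha(x,y,k)=\#\{\text{arrows }x\to y\text{ in }Q^{(k)}\}-\#\{\text{arrows }y\to x\text{ in }Q^{(k)}\}$. Then for every $k\in[0,d]$ and every $x\in (Q_1)_0$ we have $\alpha(x,a',k)=\alpha(x,b_i,k)$ for all $i\in[r]$ (the common value of $\alpha(x,b_i,k)$ over $i\in[r]$).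
   Context: A quiver is a finite directed graph with no loops and no 2-cycles. Mutation $\mu_k$ at a (non-frozen) vertex $k$: for each 2-path $i\to k\to j$ add an arrow $i\to j$, reverse all arrows incident to $k$, then delete 2-cycles. Mutation sequences are applied right to left. For a quiver $Q$ on vertices $[N]$, the framed quiver $\widehat{Q}$ is obtained by adjoining frozen vertices $1',\dots,N'$ and arrows $i\to i'$; frozen vertices are never mutated. Direct sum: given a quiver $Q_1$ on $[N_1]$, a quiver $Q_2$ on $[N_1+1,N_1+N_2]$, an ordered $k$-multiset $(a_1,\dots,a_k)$ of vertices of $Q_1$ and a $k$-multiset $(b_1,\dots,b_k)$ of vertices of $Q_2$, the quiver $Q_1\oplus_{(a_1,\dots,a_k)}^{(b_1,\dots,b_k)}Q_2$ has vertex set $[N_1+N_2]$ and arrows those of $Q_1$, those of $Q_2$, and one arrow $a_i\to b_i$ for each $i\in[k]$. -}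

module Defs where

open import Data.Nat using (ℕ; zero; suc; _+_; _*_; _∸_)
open import Data.Fin using (Fin; splitAt; _↑ˡ_; _↑ʳ_; _≟_)
open import Data.Integer using (ℤ; _⊖_)
open import Data.Sum using (_⊎_; inj₁; inj₂)
open import Data.Product using (_×_)
open import Data.Bool using (if_then_else_; _∧_)
open import Data.List using (List; foldl)
open import Data.Vec using (Vec; []; _∷_)
open import Relation.Nullary using (does; yes; no)
open import Relation.Binary.PropositionalEquality using (_≡_)

-- A quiver on vertex set Fin n, given by its arrow counts:
-- Q i j = number of arrows i → j.
Quiver : ℕ → Set
Quiver n = Fin n → Fin n → ℕ

IsQuiver : {n : ℕ} → Quiver n → Set
IsQuiver {n} Q = ((i : Fin n) → Q i i ≡ 0) × ((i j : Fin n) → (Q i j ≡ 0) ⊎ (Q j i ≡ 0))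

-- Mutation at k: add i→j for every 2-path i→k→j, reverse arrows at k,
-- then delete 2-cycles.
mutate : {n : ℕ} → Quiver n → Fin n → Quiver n
mutate Q k i j with i ≟ k | j ≟ k
... | yes _ | _     = Q j i
... | no _  | yes _ = Q j i
... | no _  | no _  = (Q i j + Q i k * Q k j) ∸ (Q j i + Q j k * Q k i)

-- Apply a mutation sequence; the head of the list is applied first
-- (the list [i₁, …, i_d] represents μ_{i_d} ∘ ⋯ ∘ μ_{i₁}).
mutateSeq : {n : ℕ} → Quiver n → List (Fin n) → Quiver n
mutateSeq = foldl mutate

countPairs : {A B k : ℕ} → Vec (Fin A) k → Vec (Fin B) k → Fin A → Fin B → ℕ
countPairs [] [] i j = 0
countPairs (a ∷ as) (b ∷ bs) i j =
  (if does (i ≟ a) ∧ does (j ≟ b) then 1 else 0) + countPairs as bs i j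

-- Direct sum Q₁ ⊕_{as}^{bs} Q₂ on Fin (N₁ + N₂); vertex y of Q₂ is
-- the vertex N₁ + y (i.e. N₁ ↑ʳ y).
directSum : {N₁ N₂ k : ℕ} → Quiver N₁ → Quiver N₂ →
            Vec (Fin N₁) k → Vec (Fin N₂) k → Quiver (N₁ + N₂)
directSum {N₁} Q₁ Q₂ as bs x y with splitAt N₁ x | splitAt N₁ y
... | inj₁ i | inj₁ j = Q₁ i j
... | inj₂ i | inj₂ j = Q₂ i j
... | inj₁ i | inj₂ j = countPairs as bs i j
... | inj₂ i | inj₁ j = 0

-- Framed quiver on Fin (N + N): vertex i (mutable) is i ↑ˡ N,
-- its frozen copy i' is N ↑ʳ i; arrows i → i'.
framed : {N : ℕ} → Quiver N → Quiver (N + N)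
framed {N} Q x y with splitAt N x | splitAt N y
... | inj₁ i | inj₁ j = Q i j
... | inj₁ i | inj₂ j = if does (i ≟ j) then 1 else 0
... | inj₂ i | _      = 0

mutableV : {N : ℕ} → Fin N → Fin (N + N)
mutableV {N} i = i ↑ˡ N

frozenV : {N : ℕ} → Fin N → Fin (N + N)
frozenV {N} i = N ↑ʳ i

left : {N₁ N₂ : ℕ} → Fin N₁ → Fin (N₁ + N₂)
left {N₁} {N₂} i = i ↑ˡ N₂

right : {N₁ N₂ : ℕ} → Fin N₂ → Fin (N₁ + N₂)
right {N₁} i = N₁ ↑ʳ i

α : {n : ℕ} → Quiver n → Fin n → Fin n → ℤ
α Q x y = Q x y ⊖ Q y x

module Submission where

-- Call two vertices y, z of a quiver "twins with respect to"
-- a family of vertices S if every x ∈ S has as many arrows to y as to z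
-- and receives as many arrows from y as from z.  Mutation at a vertex
-- k ∈ S distinct from y and z preserves this: the new arrow counts
-- between x ∈ S and y (resp. z) are built only from counts between the
-- vertices x, k ∈ S and y (resp. z), which agree by hypothesis.  Hence
-- twinness survives any mutation sequence inside S.
--
-- In the framed direct sum Q̂ with Q = Q₁ ⊕_{(a,…,a)}^{(b₁,…,b_r)} Q₂,
-- the frozen vertex a' and each b_i are twins with respect to the
-- vertices of Q₁: a vertex x of Q₁ has one arrow to a' and one to b_i
-- if x = a (the b_i being distinct), none otherwise, and neither a' nor
-- b_i has arrows into Q₁.

open import Defs
open import Data.Nat as ℕ using (ℕ; _+_; _≤_)
open import Data.Fin using (Fin; zero; suc; splitAt; _↑ˡ_; _↑ʳ_; _≟_)
open import Data.Fin.Properties using (splitAt-↑ˡ; splitAt-↑ʳ; ↑ˡ-injective; suc-injective; 0≢1+n)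
open import Data.Integer using (_⊖_)
open import Data.List using (List; []; _∷_; take; map; length)
open import Data.List.Properties using (take-map)
open import Data.Vec using (Vec; []; _∷_; lookup; replicate)
open import Data.Vec.Properties using (lookup-replicate)
open import Data.Product using (_×_; _,_; proj₁; proj₂)
open import Data.Bool using (if_then_else_)
open import Data.Empty using (⊥-elim)
open import Function using (_∘_; mk⇔)
open import Relation.Nullary using (does; yes; no)
open import Relation.Nullary.Decidable using (dec-true; dec-false; does-⇔)
open import Relation.Binary.PropositionalEquality
  using (_≡_; _≢_; refl; sym; trans; cong; cong₂; module ≡-Reasoning)

Twins : {n N : ℕ} → Quiver n → (Fin N → Fin n) → Fin n → Fin n → Set
Twins {N = N} Q f y z = (x : Fin N) → (Q (f x) y ≡ Q (f x) z) × (Q y (f x) ≡ Q z (f x))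

twins-α : {n N : ℕ} {Q : Quiver n} {f : Fin N → Fin n} {y z : Fin n} →
          Twins Q f y z → (x : Fin N) → α Q (f x) y ≡ α Q (f x) z
twins-α tw x = cong₂ _⊖_ (proj₁ (tw x)) (proj₂ (tw x))

-- Mutating at a member f w of the family, distinct from both twins,
-- keeps them twins: every count entering the mutation formula for the
-- pairs (f x, y) and (f x, z) is a count between f x or f w and a twin.
mutate-twins : {n N : ℕ} (Q : Quiver n) (f : Fin N → Fin n) {y z : Fin n} (w : Fin N) →
               y ≢ f w → z ≢ f w → Twins Q f y z → Twins (mutate Q (f w)) f y z
mutate-twins {n} Q f {y} {z} w y≢k z≢k tw x = into , out
  where
  k : Fin n
  k = f w
  into : mutate Q k (f x) y ≡ mutate Q k (f x) z
  into with f x ≟ k | y ≟ k | z ≟ k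
  ... | yes _ | _     | _     = proj₂ (tw x)
  ... | no _  | yes e | _     = ⊥-elim (y≢k e)
  ... | no _  | no _  | yes e = ⊥-elim (z≢k e)
  ... | no _  | no _  | no _
    rewrite proj₁ (tw x) | proj₂ (tw x) | proj₁ (tw w) | proj₂ (tw w) = refl
  out : mutate Q k y (f x) ≡ mutate Q k z (f x)
  out with y ≟ k | z ≟ k | f x ≟ k
  ... | yes e | _     | _     = ⊥-elim (y≢k e)
  ... | no _  | yes e | _     = ⊥-elim (z≢k e)
  ... | no _  | no _  | yes _ = proj₁ (tw x)
  ... | no _  | no _  | no _
    rewrite proj₁ (tw x) | proj₂ (tw x) | proj₁ (tw w) | proj₂ (tw w) = refl

mutateSeq-twins : {n N : ℕ} (Q : Quiver n) (f : Fin N → Fin n) {y z : Fin n} →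
                  (∀ w → y ≢ f w) → (∀ w → z ≢ f w) →
                  (ws : List (Fin N)) → Twins Q f y z → Twins (mutateSeq Q (map f ws)) f y z
mutateSeq-twins Q f y∉ z∉ []       tw = tw
mutateSeq-twins Q f y∉ z∉ (w ∷ ws) tw =
  mutateSeq-twins (mutate Q (f w)) f y∉ z∉ ws (mutate-twins Q f w (y∉ w) (z∉ w) tw)

countPairs-absentˡ : {A B k : ℕ} (as : Vec (Fin A) k) (bs : Vec (Fin B) k) (x : Fin A) (y : Fin B) →
                     (∀ j → lookup as j ≢ x) → countPairs as bs x y ≡ 0
countPairs-absentˡ []       []       x y _ = refl
countPairs-absentˡ (a ∷ as) (b ∷ bs) x y x∉
  rewrite dec-false (x ≟ a) (x∉ zero ∘ sym) = countPairs-absentˡ as bs x y (x∉ ∘ suc)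

countPairs-absentʳ : {A B k : ℕ} (as : Vec (Fin A) k) (bs : Vec (Fin B) k) (x : Fin A) (y : Fin B) →
                     (∀ j → lookup bs j ≢ y) → countPairs as bs x y ≡ 0
countPairs-absentʳ []       []       x y _ = refl
countPairs-absentʳ (a ∷ as) (b ∷ bs) x y y∉
  rewrite dec-false (y ≟ b) (y∉ zero ∘ sym) with x ≟ a
... | yes _ = countPairs-absentʳ as bs x y (y∉ ∘ suc)
... | no _  = countPairs-absentʳ as bs x y (y∉ ∘ suc)

countPairs-distinct : {A B k : ℕ} (as : Vec (Fin A) k) (bs : Vec (Fin B) k) →
                      (∀ i j → lookup bs i ≡ lookup bs j → i ≡ j) →
                      (i : Fin k) → countPairs as bs (lookup as i) (lookup bs i) ≡ 1
countPairs-distinct (a ∷ as) (b ∷ bs) distinct zero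
  rewrite dec-true (a ≟ a) refl | dec-true (b ≟ b) refl =
  cong ℕ.suc (countPairs-absentʳ as bs a b (λ j e → 0≢1+n (distinct zero (suc j) (sym e))))
countPairs-distinct (a ∷ as) (b ∷ bs) distinct (suc i)
  rewrite dec-false (lookup bs i ≟ b) (λ e → 0≢1+n (sym (distinct (suc i) zero e)))
  with lookup as i ≟ a
... | yes _ = countPairs-distinct as bs (λ i j → suc-injective ∘ distinct (suc i) (suc j)) i
... | no _  = countPairs-distinct as bs (λ i j → suc-injective ∘ distinct (suc i) (suc j)) i

↑ˡ≢↑ʳ : {m n : ℕ} (u : Fin m) (v : Fin n) → u ↑ˡ n ≢ m ↑ʳ v
↑ˡ≢↑ʳ {m} {n} u v e with trans (sym (splitAt-↑ˡ m u n)) (trans (cong (splitAt m) e) (splitAt-↑ʳ m n v))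
... | ()

frozen≢mutable : {N : ℕ} (v u : Fin N) → frozenV v ≢ mutableV u
frozen≢mutable v u = ↑ˡ≢↑ʳ u v ∘ sym

right≢left : {N₁ N₂ : ℕ} (v : Fin N₂) (u : Fin N₁) →
             mutableV (right {N₁} {N₂} v) ≢ mutableV (left {N₁} {N₂} u)
right≢left {N₁} {N₂} v u e = ↑ˡ≢↑ʳ u v (sym (↑ˡ-injective (N₁ + N₂) _ _ e))

framed-mutable : {N : ℕ} (Q : Quiver N) (u v : Fin N) → framed Q (mutableV u) (mutableV v) ≡ Q u v
framed-mutable {N} Q u v rewrite splitAt-↑ˡ N u N | splitAt-↑ˡ N v N = refl

framed-mutable-frozen : {N : ℕ} (Q : Quiver N) (u v : Fin N) →
                        framed Q (mutableV u) (frozenV v) ≡ (if does (u ≟ v) then 1 else 0)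
framed-mutable-frozen {N} Q u v rewrite splitAt-↑ˡ N u N | splitAt-↑ʳ N N v = refl

framed-frozen : {N : ℕ} (Q : Quiver N) (v : Fin N) (y : Fin (N + N)) → framed Q (frozenV v) y ≡ 0
framed-frozen {N} Q v y rewrite splitAt-↑ʳ N N v = refl

directSum-left-right : {N₁ N₂ k : ℕ} (Q₁ : Quiver N₁) (Q₂ : Quiver N₂) (as : Vec (Fin N₁) k) (bs : Vec (Fin N₂) k)
                       (u : Fin N₁) (v : Fin N₂) →
                       directSum Q₁ Q₂ as bs (left {N₁} {N₂} u) (right {N₁} {N₂} v) ≡ countPairs as bs u v
directSum-left-right {N₁} {N₂} Q₁ Q₂ as bs u v rewrite splitAt-↑ˡ N₁ u N₂ | splitAt-↑ʳ N₁ N₂ v = refl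

directSum-right-left : {N₁ N₂ k : ℕ} (Q₁ : Quiver N₁) (Q₂ : Quiver N₂) (as : Vec (Fin N₁) k) (bs : Vec (Fin N₂) k)
                       (v : Fin N₂) (u : Fin N₁) →
                       directSum Q₁ Q₂ as bs (right {N₁} {N₂} v) (left {N₁} {N₂} u) ≡ 0
directSum-right-left {N₁} {N₂} Q₁ Q₂ as bs v u rewrite splitAt-↑ʳ N₁ N₂ v | splitAt-↑ˡ N₁ u N₂ = refl

countPairs-replicate : {A B r : ℕ} (a x : Fin A) (bs : Vec (Fin B) r) →
                       (∀ i j → lookup bs i ≡ lookup bs j → i ≡ j) → (i : Fin r) →
                       countPairs (replicate r a) bs x (lookup bs i) ≡ (if does (x ≟ a) then 1 else 0)
countPairs-replicate {r = r} a x bs distinct i with x ≟ a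
... | yes refl = trans (cong (λ s → countPairs (replicate r a) bs s (lookup bs i)) (sym (lookup-replicate i a)))
                       (countPairs-distinct (replicate r a) bs distinct i)
... | no x≢a   = countPairs-absentˡ (replicate r a) bs x (lookup bs i)
                   (λ j e → x≢a (trans (sym e) (lookup-replicate j a)))

framed-directSum-twins :
  {N₁ N₂ r : ℕ} (Q₁ : Quiver N₁) (Q₂ : Quiver N₂) (a : Fin N₁) (b : Vec (Fin N₂) r) →
  (∀ i j → lookup b i ≡ lookup b j → i ≡ j) → (i : Fin r) →
  Twins (framed (directSum Q₁ Q₂ (replicate r a) b)) (mutableV ∘ left {N₁} {N₂})
        (frozenV (left {N₁} {N₂} a)) (mutableV (right {N₁} {N₂} (lookup b i)))
framed-directSum-twins {N₁} {N₂} {r} Q₁ Q₂ a b distinct i x = into , out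
  where
  open ≡-Reasoning
  Q : Quiver (N₁ + N₂)
  Q = directSum Q₁ Q₂ (replicate r a) b
  L : Fin N₁ → Fin (N₁ + N₂)
  L = left
  R : Fin N₂ → Fin (N₁ + N₂)
  R = right
  L≟L : does (L x ≟ L a) ≡ does (x ≟ a)
  L≟L = does-⇔ (mk⇔ (↑ˡ-injective N₂ x a) (cong L)) (L x ≟ L a) (x ≟ a)
  into : framed Q (mutableV (L x)) (frozenV (L a)) ≡ framed Q (mutableV (L x)) (mutableV (R (lookup b i)))
  into = begin
    framed Q (mutableV (L x)) (frozenV (L a))              ≡⟨ framed-mutable-frozen Q (L x) (L a) ⟩
    (if does (L x ≟ L a) then 1 else 0)                    ≡⟨ cong (if_then 1 else 0) L≟L ⟩
    (if does (x ≟ a) then 1 else 0)                        ≡⟨ countPairs-replicate a x b distinct i ⟨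
    countPairs (replicate r a) b x (lookup b i)            ≡⟨ directSum-left-right Q₁ Q₂ (replicate r a) b x (lookup b i) ⟨
    Q (L x) (R (lookup b i))                               ≡⟨ framed-mutable Q (L x) (R (lookup b i)) ⟨
    framed Q (mutableV (L x)) (mutableV (R (lookup b i)))  ∎
  out : framed Q (frozenV (L a)) (mutableV (L x)) ≡ framed Q (mutableV (R (lookup b i))) (mutableV (L x))
  out = begin
    framed Q (frozenV (L a)) (mutableV (L x))              ≡⟨ framed-frozen Q (L a) (mutableV (L x)) ⟩
    0                                                      ≡⟨ directSum-right-left Q₁ Q₂ (replicate r a) b (lookup b i) x ⟨
    Q (R (lookup b i)) (L x)                               ≡⟨ framed-mutable Q (R (lookup b i)) (L x) ⟨
    framed Q (mutableV (R (lookup b i))) (mutableV (L x))  ∎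

lemma3p7 : {N₁ N₂ r : ℕ} (Q₁ : Quiver N₁) (Q₂ : Quiver N₂) → IsQuiver Q₁ → IsQuiver Q₂ →
    (a : Fin N₁) (b : Vec (Fin N₂) r) → ((i j : Fin r) → lookup b i ≡ lookup b j → i ≡ j) →
    (μs : List (Fin N₁)) (k : ℕ) → k ≤ length μs → (x : Fin N₁) (i : Fin r) →
    α (mutateSeq (framed (directSum Q₁ Q₂ (replicate r a) b)) (take k (map (λ v → mutableV (left {N₁} {N₂} v)) μs)))
      (mutableV (left {N₁} {N₂} x)) (frozenV (left {N₁} {N₂} a))
    ≡ α (mutateSeq (framed (directSum Q₁ Q₂ (replicate r a) b)) (take k (map (λ v → mutableV (left {N₁} {N₂} v)) μs)))
      (mutableV (left {N₁} {N₂} x)) (mutableV (right {N₁} {N₂} (lookup b i)))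
lemma3p7 {N₁} {N₂} {r} Q₁ Q₂ _ _ a b distinct μs k _ x i
  rewrite take-map {f = mutableV ∘ left {N₁} {N₂}} k μs = twins-α {Q = Qₖ} {f = ι} twinsAfter x
  where
  ι : Fin N₁ → Fin ((N₁ + N₂) + (N₁ + N₂))
  ι = mutableV ∘ left
  a′ bᵢ : Fin ((N₁ + N₂) + (N₁ + N₂))
  a′ = frozenV (left {N₁} {N₂} a)
  bᵢ = mutableV (right {N₁} {N₂} (lookup b i))
  Qₖ : Quiver ((N₁ + N₂) + (N₁ + N₂))
  Qₖ = mutateSeq (framed (directSum Q₁ Q₂ (replicate r a) b)) (map ι (take k μs))
  twinsAfter : Twins Qₖ ι a′ bᵢ
  twinsAfter = mutateSeq-twins _ ι (λ w → frozen≢mutable (left a) (left w)) (λ w → right≢left (lookup b i) w)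
                 (take k μs) (framed-directSum-twins Q₁ Q₂ a b distinct i)
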